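{- Let $G$ be a finite simple graph with Edmonds–Gallai decomposition $V(G)=\mathcal{A}\sqcup\mathcal{C}\sqcup\mathcal{D}$, and let $G_1,\dots,G_k$ be the connected components of $G[\mathcal{D}]$. Then $\ker(G)\subseteq \bigcup_{i:\,|V(G_i)|=1} V(G_i)$.
   Context: Edmonds–Gallai decomposition: $\mathcal{D}$ is the set of vertices of $G$ that are not covered by at least one maximum matching of $G$; $\mathcal{A}$ is the set of vertices not in $\mathcal{D}$ adjacent to some vertex of $\mathcal{D}$; $\mathcal{C}=V(G)\setminus(\mathcal{A}\cup\mathcal{D})$. $G[U]$ is the induced subgraph on $U$. For $A\subseteq V(G)$, $N(A)$ is the set of vertices adjacent to some vertex of $A$, $d(A)=|A|-|N(A)|$, $d_c(G)=\max\{d(A):A\subseteq V(G)\}$, $A$ is critical if $d(A)=d_c(G)$, and $\ker(G)$ is the intersection of all critical sets of $G$. -}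

module Defs where

open import Data.Nat using (ℕ; _≤_)
open import Data.Integer using (ℤ; +_; _-_) renaming (_≤_ to _≤ℤ_)
open import Data.Bool using (Bool; true; false; _∧_)
open import Data.Fin using (Fin)
open import Data.Fin.Subset using (Subset; _∈_; _∉_; ∣_∣)
open import Data.Vec using (tabulate; lookup)
open import Data.List using (List; []; _∷_; length; allFin; concatMap)
open import Data.Bool.ListAction using (any)
open import Data.List.Relation.Unary.All using (All)
open import Data.List.Relation.Unary.Unique.Propositional using (Unique)
open import Data.List.Membership.Propositional renaming (_∈_ to _∈ₗ_; _∉_ to _∉ₗ_)
open import Data.Product using (Σ; _×_; _,_; ∃)
open import Relation.Binary.PropositionalEquality using (_≡_)
open import Relation.Nullary using (¬_)

record Graph (n : ℕ) : Set where
  field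
    adj    : Fin n → Fin n → Bool
    sym    : ∀ u v → adj u v ≡ adj v u
    irrefl : ∀ v → adj v v ≡ false

open Graph public

Adjacent : ∀ {n} → Graph n → Fin n → Fin n → Set
Adjacent G u v = adj G u v ≡ true

endpoints : ∀ {n} → List (Fin n × Fin n) → List (Fin n)
endpoints = concatMap (λ { (u , v) → u ∷ v ∷ [] })

IsMatching : ∀ {n} → Graph n → List (Fin n × Fin n) → Set
IsMatching G M = All (λ { (u , v) → Adjacent G u v }) M × Unique (endpoints M)

IsMaximumMatching : ∀ {n} → Graph n → List (Fin n × Fin n) → Set
IsMaximumMatching G M =
  IsMatching G M × (∀ M′ → IsMatching G M′ → length M′ ≤ length M)

Covers : ∀ {n} → List (Fin n × Fin n) → Fin n → Set
Covers M v = v ∈ₗ endpoints M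

InD : ∀ {n} → Graph n → Fin n → Set
InD G v = Σ _ λ M → IsMaximumMatching G M × ¬ Covers M v

N : ∀ {n} → Graph n → Subset n → Subset n
N {n} G A = tabulate λ v → any (λ u → lookup A u ∧ adj G u v) (allFin n)

d : ∀ {n} → Graph n → Subset n → ℤ
d G A = + ∣ A ∣ - + ∣ N G A ∣

Critical : ∀ {n} → Graph n → Subset n → Set
Critical G A = ∀ B → d G B ≤ℤ d G A

InKer : ∀ {n} → Graph n → Fin n → Set
InKer G v = ∀ A → Critical G A → v ∈ A

-- Reachability inside the induced subgraph G[D] (walks all of whose
-- vertices lie in D); the connected component of G[D] containing v is
-- the set of w with ReachD G v w.
data ReachD {n} (G : Graph n) : Fin n → Fin n → Set where
  here : ∀ {v} → InD G v → ReachD G v v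
  step : ∀ {v u w} → InD G v → Adjacent G v u → ReachD G u w → ReachD G v w

InSingletonComponentOfD : ∀ {n} → Graph n → Fin n → Set
InSingletonComponentOfD G v = InD G v × (∀ w → ReachD G v w → w ≡ v)

-- Let K be a critical set of minimum size. Minimality makes K independent and gives every
-- nonempty Y ⊆ N(K) more than |Y| neighbours in K: otherwise removing N(Y) from K would leave
-- a smaller critical set. By Hall's theorem N(K) can then be matched into K - v for each v ∈ K.
-- In any maximum matching the edges meeting K ∪ N(K) are at most |N(K)|, since each has an end
-- in N(K); exchanging them for that matching yields a maximum matching missing v, so v ∈ D.
-- If some maximum matching missed a neighbour u ∈ N(K) of v, the exchange would enlarge it, so
-- no neighbour of v is in D. A vertex of ker(G) lies in K, which gives the theorem.
module Submission where

open import Defs hiding (sym)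

open import Data.Bool using (true; false; _∧_; T)
import Data.Bool as Bool
open import Data.Bool.Properties using (T-≡; T-∧)
open import Data.Nat using (ℕ; zero; suc; _+_; _≤_; _<_; z≤n; s≤s)
import Data.Nat.Properties as ℕ
open import Data.Nat.Properties
  using ( _<?_; _≤?_; ≤-refl; ≤-reflexive; ≤-trans; <-≤-trans; ≤-<-trans; ≤-pred; n≮0; ≮⇒≥; ≰⇒>; <⇒≱
        ; +-suc; +-comm; +-identityʳ; m≤m+n; +-mono-≤; +-monoˡ-≤; +-monoʳ-≤; +-cancelʳ-≤
        ; module ≤-Reasoning )
open import Data.Nat.Tactic.RingSolver using (solve-∀)
import Data.Integer as ℤ
open import Data.Integer using (_⊖_)
import Data.Integer.Properties as ℤ
open import Data.Fin using (Fin; _≟_)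
open import Data.Fin.Subset
open import Data.Fin.Subset.Properties
open import Data.Vec using (_∷_; []; here; there; lookup)
open import Data.Vec.Properties using ([]=⇒lookup; lookup⇒[]=; lookup∘tabulate)
open import Data.Product using (∃; _×_; _,_; proj₁; proj₂)
open import Data.Sum using (_⊎_; inj₁; inj₂)
open import Data.Unit using (tt)
open import Data.List using (List; []; _∷_; _++_; length; allFin; filter; cartesianProduct; cartesianProductWith)
import Data.List as List
open import Data.List.Properties using (length-++)
import Data.List.Extrema as Extrema
open import Data.List.Relation.Unary.All using (All; []; _∷_)
import Data.List.Relation.Unary.All as All
import Data.List.Relation.Unary.All.Properties as AllP
open import Data.List.Relation.Unary.AllPairs using ([]; _∷_)
open import Data.List.Relation.Unary.Any using (satisfied; here; there)
open import Data.List.Relation.Unary.Any.Properties using (any⁺; any⁻)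
open import Data.List.Relation.Unary.Unique.Propositional using (Unique)
import Data.List.Relation.Unary.Unique.Propositional.Properties as UniqueP
import Data.List.Relation.Unary.Unique.DecPropositional as UniqueDec
open import Data.List.Membership.Propositional using (lose) renaming (_∈_ to _∈ₗ_)
open import Data.List.Membership.Propositional.Properties
  using (∈-allFin; ∈-++⁻; ∈-++⁺ˡ; ∈-++⁺ʳ; ∈-map⁺; ∈-filter⁺; ∈-cartesianProductWith⁺; ∈-cartesianProduct⁺)
open import Function using (_∘_)
open import Function.Bundles using (Equivalence)
open import Relation.Binary using (TotalOrder)
open import Relation.Binary.PropositionalEquality
  using (_≡_; _≢_; refl; sym; trans; cong; subst; subst₂; module ≡-Reasoning)
open import Relation.Nullary using (¬_; ¬?; Dec; does; yes; no; contradiction)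
open import Relation.Nullary.Decidable using (_×-dec_; map′)
open import Relation.Unary using (Decidable)

private variable
  n : ℕ
  p q : Subset n
  x : Fin n

[+m]-[+n]≤[+o]-[+p] : ∀ {m n o p} → m + p ≤ o + n → ℤ.+ m ℤ.- ℤ.+ n ℤ.≤ ℤ.+ o ℤ.- ℤ.+ p
[+m]-[+n]≤[+o]-[+p] {m} {n} {o} {p} m+p≤o+n = begin
  ℤ.+ m ℤ.- ℤ.+ n    ≡⟨ ℤ.[+m]-[+n]≡m⊖n m n ⟩
  m ⊖ n              ≡⟨ ℤ.+-cancelˡ-⊖ p m n ⟨
  (p + m) ⊖ (p + n)  ≤⟨ ℤ.⊖-monoˡ-≤ (p + n) p+m≤n+o ⟩
  (n + o) ⊖ (p + n)  ≡⟨ cong ((n + o) ⊖_) (+-comm p n) ⟩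
  (n + o) ⊖ (n + p)  ≡⟨ ℤ.+-cancelˡ-⊖ n o p ⟩
  o ⊖ p              ≡⟨ ℤ.[+m]-[+n]≡m⊖n o p ⟨
  ℤ.+ o ℤ.- ℤ.+ p    ∎
  where
  open ℤ.≤-Reasoning
  p+m≤n+o : p + m ≤ n + o
  p+m≤n+o = subst₂ _≤_ (+-comm m p) (+-comm o n) m+p≤o+n

Disjoint : Subset n → Subset n → Set
Disjoint p q = ∀ {x} → x ∈ p → x ∉ q

Disjoint-∪ : ∀ {p q r s : Subset n} →
  Disjoint p r → Disjoint p s → Disjoint q r → Disjoint q s → Disjoint (p ∪ q) (r ∪ s)
Disjoint-∪ {p = p} {q} {r} {s} p#r p#s q#r q#s x∈p∪q x∈r∪s
  with x∈p∪q⁻ p q x∈p∪q | x∈p∪q⁻ r s x∈r∪s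
... | inj₁ x∈p | inj₁ x∈r = p#r x∈p x∈r
... | inj₁ x∈p | inj₂ x∈s = p#s x∈p x∈s
... | inj₂ x∈q | inj₁ x∈r = q#r x∈q x∈r
... | inj₂ x∈q | inj₂ x∈s = q#s x∈q x∈s

x∈p─q⇒x∉q : ∀ (p q : Subset n) → x ∈ p ─ q → x ∉ q
x∈p─q⇒x∉q (_ ∷ p) (outside ∷ q) (there x∈p─q) (there x∈q) = x∈p─q⇒x∉q p q x∈p─q x∈q
x∈p─q⇒x∉q (_ ∷ p) (inside ∷ q) (there x∈p─q) (there x∈q) = x∈p─q⇒x∉q p q x∈p─q x∈q

∪-⊆ : ∀ {p q r : Subset n} → p ⊆ r → q ⊆ r → p ∪ q ⊆ r
∪-⊆ {p = p} {q = q} p⊆r q⊆r x∈p∪q with x∈p∪q⁻ p q x∈p∪q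
... | inj₁ x∈p = p⊆r x∈p
... | inj₂ x∈q = q⊆r x∈q

∣p∪q∣+∣p∩q∣≡∣p∣+∣q∣ : ∀ (p q : Subset n) → ∣ p ∪ q ∣ + ∣ p ∩ q ∣ ≡ ∣ p ∣ + ∣ q ∣
∣p∪q∣+∣p∩q∣≡∣p∣+∣q∣ []            []            = refl
∣p∪q∣+∣p∩q∣≡∣p∣+∣q∣ (inside  ∷ p) (inside  ∷ q) = begin
  suc (∣ p ∪ q ∣ + suc ∣ p ∩ q ∣)    ≡⟨ cong suc (+-suc ∣ p ∪ q ∣ ∣ p ∩ q ∣) ⟩
  suc (suc (∣ p ∪ q ∣ + ∣ p ∩ q ∣))  ≡⟨ cong (suc ∘ suc) (∣p∪q∣+∣p∩q∣≡∣p∣+∣q∣ p q) ⟩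
  suc (suc (∣ p ∣ + ∣ q ∣))          ≡⟨ cong suc (+-suc ∣ p ∣ ∣ q ∣) ⟨
  suc (∣ p ∣ + suc ∣ q ∣)            ∎
  where open ≡-Reasoning
∣p∪q∣+∣p∩q∣≡∣p∣+∣q∣ (inside  ∷ p) (outside ∷ q) = cong suc (∣p∪q∣+∣p∩q∣≡∣p∣+∣q∣ p q)
∣p∪q∣+∣p∩q∣≡∣p∣+∣q∣ (outside ∷ p) (inside  ∷ q) = begin
  suc (∣ p ∪ q ∣ + ∣ p ∩ q ∣)  ≡⟨ cong suc (∣p∪q∣+∣p∩q∣≡∣p∣+∣q∣ p q) ⟩
  suc (∣ p ∣ + ∣ q ∣)          ≡⟨ +-suc ∣ p ∣ ∣ q ∣ ⟨
  ∣ p ∣ + suc ∣ q ∣            ∎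
  where open ≡-Reasoning
∣p∪q∣+∣p∩q∣≡∣p∣+∣q∣ (outside ∷ p) (outside ∷ q) = ∣p∪q∣+∣p∩q∣≡∣p∣+∣q∣ p q

x∈p⇒⁅x⁆⊆p : x ∈ p → ⁅ x ⁆ ⊆ p
x∈p⇒⁅x⁆⊆p {x = x} x∈p y∈⁅x⁆ = subst (_∈ _) (sym (x∈⁅y⁆⇒x≡y x y∈⁅x⁆)) x∈p

p∩q─r⊆p∩[q─r] : ∀ (p q r : Subset n) → p ∩ q ─ r ⊆ p ∩ (q ─ r)
p∩q─r⊆p∩[q─r] p q r x∈p∩q─r =
  let x∈p , x∈q = x∈p∩q⁻ p q (p─q⊆p (p ∩ q) r x∈p∩q─r)
  in x∈p∩q⁺ (x∈p , x∈p∧x∉q⇒x∈p─q x∈q (x∈p─q⇒x∉q (p ∩ q) r x∈p∩q─r))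

0<∣p∣⇒Nonempty : ∀ {p : Subset n} → 0 < ∣ p ∣ → Nonempty p
0<∣p∣⇒Nonempty {n} {p} 0<∣p∣ with nonempty? p
... | yes ne = ne
... | no ¬ne = contradiction (subst (0 <_) (∣⊥∣≡0 n) (subst (λ s → 0 < ∣ s ∣) (Empty-unique ¬ne) 0<∣p∣)) n≮0

∣p∪q∣≤∣p∣+∣q∣ : ∀ (p q : Subset n) → ∣ p ∪ q ∣ ≤ ∣ p ∣ + ∣ q ∣
∣p∪q∣≤∣p∣+∣q∣ p q = ≤-trans (m≤m+n ∣ p ∪ q ∣ ∣ p ∩ q ∣) (≤-reflexive (∣p∪q∣+∣p∩q∣≡∣p∣+∣q∣ p q))

disjoint⇒∣p∣+∣q∣≤∣r∣ : {p q r : Subset n} → Disjoint p q → p ⊆ r → q ⊆ r → ∣ p ∣ + ∣ q ∣ ≤ ∣ r ∣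
disjoint⇒∣p∣+∣q∣≤∣r∣ {n} {p} {q} {r} p#q p⊆r q⊆r = begin
  ∣ p ∣ + ∣ q ∣             ≡⟨ ∣p∪q∣+∣p∩q∣≡∣p∣+∣q∣ p q ⟨
  ∣ p ∪ q ∣ + ∣ p ∩ q ∣     ≡⟨ cong (λ s → ∣ p ∪ q ∣ + ∣ s ∣) (Empty-unique p∩q-empty) ⟩
  ∣ p ∪ q ∣ + ∣ ⊥ {n} ∣     ≡⟨ cong (∣ p ∪ q ∣ +_) (∣⊥∣≡0 n) ⟩
  ∣ p ∪ q ∣ + 0             ≡⟨ +-identityʳ ∣ p ∪ q ∣ ⟩
  ∣ p ∪ q ∣                 ≤⟨ p⊆q⇒∣p∣≤∣q∣ (∪-⊆ p⊆r q⊆r) ⟩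
  ∣ r ∣                     ∎
  where
  open ≤-Reasoning
  p∩q-empty : Empty (p ∩ q)
  p∩q-empty (x , x∈p∩q) = let x∈p , x∈q = x∈p∩q⁻ p q x∈p∩q in p#q x∈p x∈q

∣p∣≤∣p∩q∣+∣p─q∣ : ∀ (p q : Subset n) → ∣ p ∣ ≤ ∣ p ∩ q ∣ + ∣ p ─ q ∣
∣p∣≤∣p∩q∣+∣p─q∣ p q = ≤-trans (p⊆q⇒∣p∣≤∣q∣ p⊆p∩q∪p─q) (∣p∪q∣≤∣p∣+∣q∣ (p ∩ q) (p ─ q))
  where
  p⊆p∩q∪p─q : p ⊆ p ∩ q ∪ (p ─ q)
  p⊆p∩q∪p─q {x} x∈p with x ∈? q
  ... | yes x∈q = x∈p∪q⁺ (inj₁ (x∈p∩q⁺ (x∈p , x∈q)))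
  ... | no x∉q  = x∈p∪q⁺ (inj₂ (x∈p∧x∉q⇒x∈p─q x∈p x∉q))

∣p∣≤∣q∣+∣p─q∣ : ∀ (p q : Subset n) → ∣ p ∣ ≤ ∣ q ∣ + ∣ p ─ q ∣
∣p∣≤∣q∣+∣p─q∣ p q = ≤-trans (∣p∣≤∣p∩q∣+∣p─q∣ p q) (+-monoˡ-≤ ∣ p ─ q ∣ (∣p∩q∣≤∣q∣ p q))

∣p∣≤1+∣p-x∣ : ∀ (p : Subset n) x → ∣ p ∣ ≤ suc ∣ p - x ∣
∣p∣≤1+∣p-x∣ p x = subst (λ k → ∣ p ∣ ≤ k + ∣ p - x ∣) (∣⁅x⁆∣≡1 x) (∣p∣≤∣q∣+∣p─q∣ p ⁅ x ⁆)

endpoints-++ : ∀ (P Q : List (Fin n × Fin n)) → endpoints (P ++ Q) ≡ endpoints P ++ endpoints Q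
endpoints-++ []            Q = refl
endpoints-++ ((a , b) ∷ P) Q = cong (λ es → a ∷ b ∷ es) (endpoints-++ P Q)

All-endpoints : ∀ {E : Fin n × Fin n → Set} {X : Fin n → Set} →
  (∀ {a b} → E (a , b) → X a × X b) → ∀ {M} → All E M → All X (endpoints M)
All-endpoints E⇒X []       = []
All-endpoints E⇒X (e ∷ es) = let Xa , Xb = E⇒X e in Xa ∷ Xb ∷ All-endpoints E⇒X es

module _ {E : Fin n × Fin n → Set} (E? : Decidable E) where

  All-endpoints-filter : ∀ {X : Fin n → Set} M → All X (endpoints M) → All X (endpoints (filter E? M))
  All-endpoints-filter []      []               = []
  All-endpoints-filter (e@(a , b) ∷ M) (Xa ∷ Xb ∷ X-M) with does (E? e)
  ... | true  = Xa ∷ Xb ∷ All-endpoints-filter M X-M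
  ... | false = All-endpoints-filter M X-M

  Unique-endpoints-filter : ∀ M → Unique (endpoints M) → Unique (endpoints (filter E? M))
  Unique-endpoints-filter []      []                                 = []
  Unique-endpoints-filter (e@(a , b) ∷ M) ((a≢b ∷ a≢M) ∷ (b≢M ∷ M-unique)) with does (E? e)
  ... | true  = (a≢b ∷ All-endpoints-filter M a≢M)
              ∷ (All-endpoints-filter M b≢M ∷ Unique-endpoints-filter M M-unique)
  ... | false = Unique-endpoints-filter M M-unique

length≡length-filter+length-filter¬ : ∀ {A : Set} {P : A → Set} (P? : Decidable P) xs →
  length xs ≡ length (filter P? xs) + length (filter (¬? ∘ P?) xs)
length≡length-filter+length-filter¬ P? []       = refl
length≡length-filter+length-filter¬ P? (x ∷ xs) with P? x
... | yes _ = cong suc (length≡length-filter+length-filter¬ P? xs)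
... | no  _ = trans (cong suc (length≡length-filter+length-filter¬ P? xs)) (sym (+-suc _ _))

Meets : Subset n → Fin n × Fin n → Set
Meets S (a , b) = a ∈ S ⊎ b ∈ S

Meets-─ : ∀ {S : Subset n} {c M} → All (c ≢_) (endpoints M) → All (Meets S) M → All (Meets (S - c)) M
Meets-─ {M = []}    []                 []           = []
Meets-─ {S = S} {c} {(a , b) ∷ M} (c≢a ∷ c≢b ∷ c≢M) (meets ∷ ms) = meets′ meets ∷ Meets-─ c≢M ms
  where
  meets′ : Meets S (a , b) → Meets (S - c) (a , b)
  meets′ (inj₁ a∈S) = inj₁ (x∈p∧x≢y⇒x∈p-y a∈S (c≢a ∘ sym))
  meets′ (inj₂ b∈S) = inj₂ (x∈p∧x≢y⇒x∈p-y b∈S (c≢b ∘ sym))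

-- Choosing for each edge an endpoint in S is injective.
length≤∣S∣ : ∀ {S : Subset n} {M} → Unique (endpoints M) → All (Meets S) M → length M ≤ ∣ S ∣
length≤∣S∣ {M = []}    []                        []                = z≤n
length≤∣S∣ {M = (a , b) ∷ M} ((_ ∷ a≢M) ∷ (b≢M ∷ M-unique)) (inj₁ a∈S ∷ ms) =
  <-≤-trans (s≤s (length≤∣S∣ M-unique (Meets-─ a≢M ms))) (x∈p⇒∣p-x∣<∣p∣ a∈S)
length≤∣S∣ {M = (a , b) ∷ M} ((_ ∷ a≢M) ∷ (b≢M ∷ M-unique)) (inj₂ b∈S ∷ ms) =
  <-≤-trans (s≤s (length≤∣S∣ M-unique (Meets-─ b≢M ms))) (x∈p⇒∣p-x∣<∣p∣ b∈S)

subsets : ∀ n → List (Subset n)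
subsets zero    = [] ∷ []
subsets (suc n) = List.map (inside ∷_) (subsets n) ++ List.map (outside ∷_) (subsets n)

∈-subsets : ∀ (p : Subset n) → p ∈ₗ subsets n
∈-subsets []            = here refl
∈-subsets (inside  ∷ p) = ∈-++⁺ˡ (∈-map⁺ (inside ∷_) (∈-subsets p))
∈-subsets (outside ∷ p) = ∈-++⁺ʳ (List.map (inside ∷_) (subsets _)) (∈-map⁺ (outside ∷_) (∈-subsets p))

listsUpTo : ∀ {A : Set} → List A → ℕ → List (List A)
listsUpTo xs zero    = [] ∷ []
listsUpTo xs (suc k) = [] ∷ cartesianProductWith _∷_ xs (listsUpTo xs k)

∈-listsUpTo : ∀ {A : Set} {xs ys : List A} k → All (_∈ₗ xs) ys → length ys ≤ k → ys ∈ₗ listsUpTo xs k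
∈-listsUpTo zero    []           z≤n         = here refl
∈-listsUpTo (suc k) []           _           = here refl
∈-listsUpTo (suc k) (y∈xs ∷ ys∈) (s≤s ∣ys∣≤k) =
  there (∈-cartesianProductWith⁺ _∷_ y∈xs (∈-listsUpTo k ys∈ ∣ys∣≤k))

module _ {b ℓ₁ ℓ₂} (O : TotalOrder b ℓ₁ ℓ₂)
         {A : Set} {P : A → Set} (P? : Decidable P) (f : A → TotalOrder.Carrier O) where
  open TotalOrder O using () renaming (_≤_ to _≼_)
  open Extrema O

  maximiser : ∀ x₀ xs → P x₀ → (∀ {y} → P y → y ∈ₗ xs) → ∃ λ x → P x × ∀ {y} → P y → f y ≼ f x
  maximiser x₀ xs Px₀ complete =
    argmax f x₀ (filter P? xs) ,
    argmax-all f Px₀ (AllP.all-filter P? xs) ,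
    λ Py → All.lookup (f[xs]≤f[argmax] x₀ (filter P? xs)) (∈-filter⁺ P? (complete Py) Py)

  minimiser : ∀ x₀ xs → P x₀ → (∀ {y} → P y → y ∈ₗ xs) → ∃ λ x → P x × ∀ {y} → P y → f x ≼ f y
  minimiser x₀ xs Px₀ complete =
    argmin f x₀ (filter P? xs) ,
    argmin-all f Px₀ (AllP.all-filter P? xs) ,
    λ Py → All.lookup (f[argmin]≤f[xs] x₀ (filter P? xs)) (∈-filter⁺ P? (complete Py) Py)

module _ (G : Graph n) where

  Adjacent-sym : ∀ {u v} → Adjacent G u v → Adjacent G v u
  Adjacent-sym {u} {v} u~v = trans (Graph.sym G v u) u~v

  ∈N⁺ : ∀ {A u v} → u ∈ A → Adjacent G u v → v ∈ N G A
  ∈N⁺ {A} {u} {v} u∈A u~v = lookup⇒[]= v (N G A)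
    (trans (lookup∘tabulate _ v) (Equivalence.to T-≡ (any⁺ _ (lose (∈-allFin u) Tu∧v))))
    where
    Tu∧v : T (lookup A u ∧ adj G u v)
    Tu∧v = Equivalence.from T-∧ (Equivalence.from T-≡ ([]=⇒lookup u∈A) , Equivalence.from T-≡ u~v)

  ∈N⁻ : ∀ {A v} → v ∈ N G A → ∃ λ u → u ∈ A × Adjacent G u v
  ∈N⁻ {A} {v} v∈NA =
    let u , Tu∧v = satisfied (any⁻ _ (allFin n)
                     (Equivalence.from T-≡ (trans (sym (lookup∘tabulate _ v)) ([]=⇒lookup v∈NA))))
        Tu , Tu~v = Equivalence.to T-∧ Tu∧v
    in u , lookup⇒[]= u A (Equivalence.to T-≡ Tu) , Equivalence.to T-≡ Tu~v

  N-mono : ∀ {A B} → A ⊆ B → N G A ⊆ N G B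
  N-mono A⊆B v∈NA = let u , u∈A , u~v = ∈N⁻ v∈NA in ∈N⁺ (A⊆B u∈A) u~v

  ∈N-∪⁻ : ∀ A B {v} → v ∈ N G (A ∪ B) → v ∈ N G A ⊎ v ∈ N G B
  ∈N-∪⁻ A B v∈N with ∈N⁻ v∈N
  ... | u , u∈A∪B , u~v with x∈p∪q⁻ A B u∈A∪B
  ...   | inj₁ u∈A = inj₁ (∈N⁺ u∈A u~v)
  ...   | inj₂ u∈B = inj₂ (∈N⁺ u∈B u~v)

  FromTo : Subset n → Subset n → Fin n × Fin n → Set
  FromTo L R (a , b) = a ∈ L × b ∈ R

  endpoints-FromTo : ∀ {L R P} → All (FromTo L R) P → All (_∈ L ∪ R) (endpoints P)
  endpoints-FromTo = All-endpoints (λ (a∈L , b∈R) → x∈p∪q⁺ (inj₁ a∈L) , x∈p∪q⁺ (inj₂ b∈R))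

  IsMatching-++ : ∀ {S T P Q} → Disjoint S T → All (_∈ S) (endpoints P) → All (_∈ T) (endpoints Q) →
    IsMatching G P → IsMatching G Q → IsMatching G (P ++ Q)
  IsMatching-++ {P = P} {Q} S#T P⊆S Q⊆T (P-adjacent , P-unique) (Q-adjacent , Q-unique) =
    AllP.++⁺ P-adjacent Q-adjacent ,
    subst Unique (sym (endpoints-++ P Q))
      (UniqueP.++⁺ P-unique Q-unique (λ (x∈P , x∈Q) → S#T (All.lookup P⊆S x∈P) (All.lookup Q⊆T x∈Q)))

  record Saturating (L R : Subset n) : Set where
    field
      edges      : List (Fin n × Fin n)
      matching   : IsMatching G edges
      from-to    : All (FromTo L R) edges
      saturating : ∣ L ∣ ≤ length edges

  open Saturating

  single-edge : ∀ {u v} → u ≢ v → Adjacent G u v → Saturating ⁅ u ⁆ ⁅ v ⁆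
  single-edge {u} {v} u≢v u~v = record
    { edges      = (u , v) ∷ []
    ; matching   = (u~v ∷ []) , ((u≢v ∷ []) ∷ [] ∷ [])
    ; from-to    = (x∈⁅x⁆ u , x∈⁅x⁆ v) ∷ []
    ; saturating = ≤-reflexive (∣⁅x⁆∣≡1 u)
    }

  Saturating-++ : ∀ {L R L₁ R₁ L₂ R₂} → Disjoint (L₁ ∪ R₁) (L₂ ∪ R₂) →
    L₁ ⊆ L → L₂ ⊆ L → R₁ ⊆ R → R₂ ⊆ R → ∣ L ∣ ≤ ∣ L₁ ∣ + ∣ L₂ ∣ →
    Saturating L₁ R₁ → Saturating L₂ R₂ → Saturating L R
  Saturating-++ #₁₂ L₁⊆L L₂⊆L R₁⊆R R₂⊆R ∣L∣≤ S₁ S₂ = record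
    { edges      = edges S₁ ++ edges S₂
    ; matching   = IsMatching-++ #₁₂ (endpoints-FromTo (from-to S₁)) (endpoints-FromTo (from-to S₂))
                     (matching S₁) (matching S₂)
    ; from-to    = AllP.++⁺ (All.map (λ (a∈L₁ , b∈R₁) → L₁⊆L a∈L₁ , R₁⊆R b∈R₁) (from-to S₁))
                            (All.map (λ (a∈L₂ , b∈R₂) → L₂⊆L a∈L₂ , R₂⊆R b∈R₂) (from-to S₂))
    ; saturating = ≤-trans ∣L∣≤ (≤-trans (+-mono-≤ (saturating S₁) (saturating S₂))
                     (≤-reflexive (sym (length-++ (edges S₁)))))
    }

  HallCondition : Subset n → Subset n → Set
  HallCondition L R = ∀ Y → Y ⊆ L → ∣ Y ∣ ≤ ∣ N G Y ∩ R ∣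

  PositiveSurplus : Subset n → Subset n → Set
  PositiveSurplus L R = ∀ Y → Y ⊆ L → 0 < ∣ Y ∣ → ∣ Y ∣ < ∣ N G Y ∩ R ∣

  PositiveSurplus⇒HallCondition : ∀ {L R} → PositiveSurplus L R → ∀ r → HallCondition L (R - r)
  PositiveSurplus⇒HallCondition {L} {R} surplus r Y Y⊆L with 0 <? ∣ Y ∣
  ... | no ∣Y∣≯0  = ≤-trans (≮⇒≥ ∣Y∣≯0) z≤n
  ... | yes 0<∣Y∣ = ≤-pred (begin-strict
    ∣ Y ∣                     <⟨ surplus Y Y⊆L 0<∣Y∣ ⟩
    ∣ N G Y ∩ R ∣             ≤⟨ ∣p∣≤1+∣p-x∣ (N G Y ∩ R) r ⟩
    suc ∣ N G Y ∩ R - r ∣     ≤⟨ s≤s (p⊆q⇒∣p∣≤∣q∣ (p∩q─r⊆p∩[q─r] (N G Y) R ⁅ r ⁆)) ⟩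
    suc ∣ N G Y ∩ (R - r) ∣   ∎)
    where open ≤-Reasoning

  Tight : Subset n → Subset n → Subset n → Set
  Tight L R Y = Y ⊆ L × 0 < ∣ Y ∣ × ∣ Y ∣ < ∣ L ∣ × ∣ N G Y ∩ R ∣ ≤ ∣ Y ∣

  tight? : ∀ L R Y → Dec (Tight L R Y)
  tight? L R Y = Y ⊆? L ×-dec 0 <? ∣ Y ∣ ×-dec ∣ Y ∣ <? ∣ L ∣ ×-dec ∣ N G Y ∩ R ∣ ≤? ∣ Y ∣

  HallInduction : Subset n → Set
  HallInduction L = ∀ {L′ R′} → ∣ L′ ∣ < ∣ L ∣ → Disjoint L′ R′ → HallCondition L′ R′ → Saturating L′ R′

  -- A tight set Y splits the problem into matching Y into N(Y) ∩ R and L ─ Y into R ─ N(Y).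
  hall-tight : ∀ {L R Y} → HallInduction L → Disjoint L R → HallCondition L R → Tight L R Y → Saturating L R
  hall-tight {L} {R} {Y} rec L#R hallLR (Y⊆L , 0<∣Y∣ , ∣Y∣<∣L∣ , ∣NY∩R∣≤∣Y∣) =
    Saturating-++ (Disjoint-∪ (λ y∈Y y∈L─Y → x∈p─q⇒x∉q L Y y∈L─Y y∈Y)
                              (λ y∈Y y∈R─NY → L#R (Y⊆L y∈Y) (p─q⊆p R (N G Y) y∈R─NY))
                              (λ x∈NY∩R x∈L─Y → L#R (p─q⊆p L Y x∈L─Y) (p∩q⊆q (N G Y) R x∈NY∩R))
                              (λ x∈NY∩R x∈R─NY → x∈p─q⇒x∉q R (N G Y) x∈R─NY (p∩q⊆p (N G Y) R x∈NY∩R)))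
      Y⊆L (p─q⊆p L Y) (p∩q⊆q (N G Y) R) (p─q⊆p R (N G Y)) (∣p∣≤∣q∣+∣p─q∣ L Y)
      (rec ∣Y∣<∣L∣ (λ y∈Y → L#R (Y⊆L y∈Y) ∘ p∩q⊆q (N G Y) R) hall₁)
      (rec ∣L─Y∣<∣L∣ (λ x∈L─Y → L#R (p─q⊆p L Y x∈L─Y) ∘ p─q⊆p R (N G Y)) hall₂)
    where
    ∣L─Y∣<∣L∣ : ∣ L ─ Y ∣ < ∣ L ∣
    ∣L─Y∣<∣L∣ = let y , y∈Y = 0<∣p∣⇒Nonempty 0<∣Y∣ in p∩q≢∅⇒∣p─q∣<∣p∣ L Y (y , x∈p∩q⁺ (Y⊆L y∈Y , y∈Y))

    hall₁ : HallCondition Y (N G Y ∩ R)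
    hall₁ Z Z⊆Y = ≤-trans (hallLR Z (⊆-trans Z⊆Y Y⊆L)) (p⊆q⇒∣p∣≤∣q∣ λ x∈NZ∩R →
      let x∈NZ , x∈R = x∈p∩q⁻ (N G Z) R x∈NZ∩R in x∈p∩q⁺ (x∈NZ , x∈p∩q⁺ (N-mono Z⊆Y x∈NZ , x∈R)))

    hall₂ : HallCondition (L ─ Y) (R ─ N G Y)
    hall₂ Z Z⊆L─Y = +-cancelʳ-≤ ∣ Y ∣ ∣ Z ∣ _ (begin
      ∣ Z ∣ + ∣ Y ∣                                 ≤⟨ disjoint⇒∣p∣+∣q∣≤∣r∣ Z#Y (p⊆p∪q Y) (q⊆p∪q Z Y) ⟩
      ∣ Z ∪ Y ∣                                     ≤⟨ hallLR (Z ∪ Y) (∪-⊆ (⊆-trans Z⊆L─Y (p─q⊆p L Y)) Y⊆L) ⟩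
      ∣ N G (Z ∪ Y) ∩ R ∣                           ≤⟨ p⊆q⇒∣p∣≤∣q∣ split ⟩
      ∣ N G Z ∩ (R ─ N G Y) ∪ N G Y ∩ R ∣           ≤⟨ ∣p∪q∣≤∣p∣+∣q∣ (N G Z ∩ (R ─ N G Y)) (N G Y ∩ R) ⟩
      ∣ N G Z ∩ (R ─ N G Y) ∣ + ∣ N G Y ∩ R ∣       ≤⟨ +-monoʳ-≤ ∣ N G Z ∩ (R ─ N G Y) ∣ ∣NY∩R∣≤∣Y∣ ⟩
      ∣ N G Z ∩ (R ─ N G Y) ∣ + ∣ Y ∣               ∎)
      where
      open ≤-Reasoning
      Z#Y : Disjoint Z Y
      Z#Y z∈Z = x∈p─q⇒x∉q L Y (Z⊆L─Y z∈Z)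
      split : N G (Z ∪ Y) ∩ R ⊆ N G Z ∩ (R ─ N G Y) ∪ N G Y ∩ R
      split {x} x∈N[Z∪Y]∩R with x∈p∩q⁻ (N G (Z ∪ Y)) R x∈N[Z∪Y]∩R | x ∈? N G Y
      ... | _ , x∈R | yes x∈NY = x∈p∪q⁺ (inj₂ (x∈p∩q⁺ (x∈NY , x∈R)))
      ... | x∈N[Z∪Y] , x∈R | no x∉NY with ∈N-∪⁻ Z Y x∈N[Z∪Y]
      ...   | inj₁ x∈NZ = x∈p∪q⁺ (inj₁ (x∈p∩q⁺ (x∈NZ , x∈p∧x∉q⇒x∈p─q x∈R x∉NY)))
      ...   | inj₂ x∈NY = contradiction x∈NY x∉NY

  -- Without tight sets every nonempty Y ⊆ L has a spare neighbour, so one edge y r can be fixed freely.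
  hall-loose : ∀ {L R} → HallInduction L → Disjoint L R → HallCondition L R → ¬ ∃ (Tight L R) → Saturating L R
  hall-loose {L} {R} rec L#R hallLR no-tight with 0 <? ∣ L ∣
  ... | no ∣L∣≯0 = record { edges = [] ; matching = [] , [] ; from-to = [] ; saturating = ≮⇒≥ ∣L∣≯0 }
  ... | yes 0<∣L∣ with 0<∣p∣⇒Nonempty 0<∣L∣
  ... | y , y∈L =
    Saturating-++ (Disjoint-∪ (λ x∈⁅y⁆ x∈L-y → x∈p─q⇒x∉q L ⁅ y ⁆ x∈L-y x∈⁅y⁆)
                              (λ x∈⁅y⁆ → L#R (x∈p⇒⁅x⁆⊆p y∈L x∈⁅y⁆) ∘ p─q⊆p R ⁅ r ⁆)
                              (λ x∈⁅r⁆ x∈L-y → L#R (p─q⊆p L ⁅ y ⁆ x∈L-y) (x∈p⇒⁅x⁆⊆p r∈R x∈⁅r⁆))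
                              (λ x∈⁅r⁆ x∈R-r → x∈p─q⇒x∉q R ⁅ r ⁆ x∈R-r x∈⁅r⁆))
      (x∈p⇒⁅x⁆⊆p y∈L) (p─q⊆p L ⁅ y ⁆) (x∈p⇒⁅x⁆⊆p r∈R) (p─q⊆p R ⁅ r ⁆) (∣p∣≤∣q∣+∣p─q∣ L ⁅ y ⁆)
      (single-edge (λ y≡r → L#R y∈L (subst (_∈ R) (sym y≡r) r∈R)) y~r)
      (rec (x∈p⇒∣p-x∣<∣p∣ y∈L) (λ x∈L-y → L#R (p─q⊆p L ⁅ y ⁆ x∈L-y) ∘ p─q⊆p R ⁅ r ⁆) hall′)
    where
    r-neighbour : Nonempty (N G ⁅ y ⁆ ∩ R)
    r-neighbour = 0<∣p∣⇒Nonempty (<-≤-trans (s≤s z≤n) (subst (_≤ ∣ N G ⁅ y ⁆ ∩ R ∣) (∣⁅x⁆∣≡1 y)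
                    (hallLR ⁅ y ⁆ (x∈p⇒⁅x⁆⊆p y∈L))))
    r : Fin n
    r = proj₁ r-neighbour
    r∈R : r ∈ R
    r∈R = proj₂ (x∈p∩q⁻ (N G ⁅ y ⁆) R (proj₂ r-neighbour))
    y~r : Adjacent G y r
    y~r with ∈N⁻ (proj₁ (x∈p∩q⁻ (N G ⁅ y ⁆) R (proj₂ r-neighbour)))
    ... | u , u∈⁅y⁆ , u~r = subst (λ w → Adjacent G w r) (x∈⁅y⁆⇒x≡y y u∈⁅y⁆) u~r

    hall′ : HallCondition (L - y) (R - r)
    hall′ = PositiveSurplus⇒HallCondition (λ Z Z⊆L-y 0<∣Z∣ → ≰⇒> λ ∣NZ∩R∣≤∣Z∣ → no-tight
      (Z , p─q⊆p L ⁅ y ⁆ ∘ Z⊆L-y , 0<∣Z∣ , ≤-<-trans (p⊆q⇒∣p∣≤∣q∣ Z⊆L-y) (x∈p⇒∣p-x∣<∣p∣ y∈L) , ∣NZ∩R∣≤∣Z∣)) r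

  hall-step : ∀ {L R} → HallInduction L → Disjoint L R → HallCondition L R → Saturating L R
  hall-step {L} {R} rec L#R hallLR with anySubset? (tight? L R)
  ... | yes (_ , tight) = hall-tight rec L#R hallLR tight
  ... | no no-tight     = hall-loose rec L#R hallLR no-tight

  hall-bounded : ∀ m {L} → ∣ L ∣ ≤ m → HallInduction L
  hall-bounded zero    ∣L∣≤0   {L′} ∣L′∣<∣L∣ = contradiction (<-≤-trans ∣L′∣<∣L∣ ∣L∣≤0) n≮0
  hall-bounded (suc m) ∣L∣≤1+m {L′} ∣L′∣<∣L∣ =
    hall-step (hall-bounded m {L′} (≤-pred (<-≤-trans ∣L′∣<∣L∣ ∣L∣≤1+m)))

  hall : ∀ {L R} → Disjoint L R → HallCondition L R → Saturating L R
  hall {L} = hall-step (hall-bounded ∣ L ∣ {L} ≤-refl)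

  isMatching? : Decidable (IsMatching G)
  isMatching? M = All.all? (λ (a , b) → adj G a b Bool.≟ true) M ×-dec UniqueDec.unique? _≟_ (endpoints M)

  IsMatching⇒length≤n : ∀ {M} → IsMatching G M → length M ≤ n
  IsMatching⇒length≤n {M} (_ , M-unique) =
    subst (length M ≤_) (∣⊤∣≡n n) (length≤∣S∣ M-unique (All.universal (λ _ → inj₁ ∈⊤) M))

  maximum-matching : ∃ (IsMaximumMatching G)
  maximum-matching =
    let M , M-matching , M-max =
          maximiser ℕ.≤-totalOrder isMatching? length [] (listsUpTo pairs n) ([] , []) complete
    in M , M-matching , λ M′ → M-max {M′}
    where
    pairs : List (Fin n × Fin n)
    pairs = cartesianProduct (allFin n) (allFin n)
    complete : ∀ {M} → IsMatching G M → M ∈ₗ listsUpTo pairs n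
    complete {M} M-matching = ∈-listsUpTo n
      (All.universal (λ (a , b) → ∈-cartesianProduct⁺ (∈-allFin a) (∈-allFin b)) M)
      (IsMatching⇒length≤n M-matching)

  critical-exists : ∃ (Critical G)
  critical-exists =
    let K , _ , K-max = maximiser ℤ.≤-totalOrder (λ _ → yes tt) (d G) ⊥ (subsets n) tt (λ _ → ∈-subsets _)
    in K , λ B → K-max {B} tt

  critical? : Decidable (Critical G)
  critical? A =
    map′ (λ dK₀≤dA B → ℤ.≤-trans (K₀-critical B) dK₀≤dA) (λ A-critical → A-critical K₀) (d G K₀ ℤ.≤? d G A)
    where
    K₀ : Subset n
    K₀ = proj₁ critical-exists
    K₀-critical : Critical G K₀
    K₀-critical = proj₂ critical-exists

  minimum-critical : ∃ λ K → Critical G K × ∀ {B} → Critical G B → ∣ K ∣ ≤ ∣ B ∣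
  minimum-critical = minimiser ℕ.≤-totalOrder critical? ∣_∣
    (proj₁ critical-exists) (subsets n) (proj₂ critical-exists) (λ {B} _ → ∈-subsets B)

  d≤d : ∀ A B → ∣ A ∣ + ∣ N G B ∣ ≤ ∣ B ∣ + ∣ N G A ∣ → d G A ℤ.≤ d G B
  d≤d A B = [+m]-[+n]≤[+o]-[+p] {∣ A ∣} {∣ N G A ∣} {∣ B ∣} {∣ N G B ∣}

  N[A─NB]#B : ∀ A B → Disjoint (N G (A ─ N G B)) B
  N[A─NB]#B A B x∈N[A─NB] x∈B =
    let t , t∈A─NB , t~x = ∈N⁻ x∈N[A─NB]
    in x∈p─q⇒x∉q A (N G B) t∈A─NB (∈N⁺ x∈B (Adjacent-sym t~x))

  module MinimumCritical {K} (K-critical : Critical G K) (K-minimum : ∀ {B} → Critical G B → ∣ K ∣ ≤ ∣ B ∣) where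

    -- Otherwise K ─ X would be a smaller critical set.
    cut-bound : ∀ X → Nonempty (K ∩ X) → ¬ (∣ N G (K ─ X) ∣ + ∣ K ∩ X ∣ ≤ ∣ N G K ∣)
    cut-bound X K∩X≠∅ bound = <⇒≱ (p∩q≢∅⇒∣p─q∣<∣p∣ K X K∩X≠∅) (K-minimum {K ─ X} K─X-critical)
      where
      rearrange : ∀ a b c → a + b + c ≡ b + (c + a)
      rearrange = solve-∀
      K─X-critical : Critical G (K ─ X)
      K─X-critical B = ℤ.≤-trans (K-critical B) (d≤d K (K ─ X) (begin
        ∣ K ∣ + ∣ N G (K ─ X) ∣                       ≤⟨ +-monoˡ-≤ ∣ N G (K ─ X) ∣ (∣p∣≤∣p∩q∣+∣p─q∣ K X) ⟩
        ∣ K ∩ X ∣ + ∣ K ─ X ∣ + ∣ N G (K ─ X) ∣       ≡⟨ rearrange (∣ K ∩ X ∣) (∣ K ─ X ∣) (∣ N G (K ─ X) ∣) ⟩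
        ∣ K ─ X ∣ + (∣ N G (K ─ X) ∣ + ∣ K ∩ X ∣)     ≤⟨ +-monoʳ-≤ ∣ K ─ X ∣ bound ⟩
        ∣ K ─ X ∣ + ∣ N G K ∣                         ∎))
        where open ≤-Reasoning

    independent : Disjoint K (N G K)
    independent x∈K x∈NK = cut-bound (N G K) (_ , x∈p∩q⁺ (x∈K , x∈NK))
      (disjoint⇒∣p∣+∣q∣≤∣r∣ (λ y∈N y∈K∩NK → N[A─NB]#B K K y∈N (p∩q⊆p K (N G K) y∈K∩NK))
        (N-mono (p─q⊆p K (N G K))) (p∩q⊆q K (N G K)))

    surplus : PositiveSurplus (N G K) K
    surplus Y Y⊆NK 0<∣Y∣ = ≰⇒> λ ∣NY∩K∣≤∣Y∣ → cut-bound (N G Y) K∩NY≠∅ (begin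
      ∣ N G (K ─ N G Y) ∣ + ∣ K ∩ N G Y ∣    ≡⟨ cong (λ S → ∣ N G (K ─ N G Y) ∣ + ∣ S ∣) (∩-comm K (N G Y)) ⟩
      ∣ N G (K ─ N G Y) ∣ + ∣ N G Y ∩ K ∣    ≤⟨ +-monoʳ-≤ ∣ N G (K ─ N G Y) ∣ ∣NY∩K∣≤∣Y∣ ⟩
      ∣ N G (K ─ N G Y) ∣ + ∣ Y ∣            ≤⟨ disjoint⇒∣p∣+∣q∣≤∣r∣ (N[A─NB]#B K Y) (N-mono (p─q⊆p K (N G Y))) Y⊆NK ⟩
      ∣ N G K ∣                              ∎)
      where
      open ≤-Reasoning
      K∩NY≠∅ : Nonempty (K ∩ N G Y)
      K∩NY≠∅ with 0<∣p∣⇒Nonempty 0<∣Y∣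
      ... | y , y∈Y with ∈N⁻ (Y⊆NK y∈Y)
      ...   | k , k∈K , k~y = k , x∈p∩q⁺ (k∈K , ∈N⁺ y∈Y (Adjacent-sym k~y))

  IsMatching-filter : ∀ {E : Fin n × Fin n → Set} (E? : Decidable E) {M} →
    IsMatching G M → IsMatching G (filter E? M)
  IsMatching-filter E? {M} (M-adjacent , M-unique) =
    AllP.filter⁺ E? M-adjacent , Unique-endpoints-filter E? M M-unique

  -- Every edge of M touching K ∪ N(K) has an end in N(K), so P, which saturates N(K),
  -- is at least as large as the part of M it replaces.
  module Augmentation {K v} (K-independent : Disjoint K (N G K)) (v∈K : v ∈ K)
                      (P : Saturating (N G K) (K - v)) where

    C : Subset n
    C = K ∪ N G K

    Outside : Fin n × Fin n → Set
    Outside (a , b) = a ∉ C × b ∉ C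

    outside? : Decidable Outside
    outside? (a , b) = ¬? (a ∈? C) ×-dec ¬? (b ∈? C)

    touching? : Decidable (¬_ ∘ Outside)
    touching? = ¬? ∘ outside?

    augment : List (Fin n × Fin n) → List (Fin n × Fin n)
    augment M = edges P ++ filter outside? M

    outside-endpoints : ∀ M → All (_∈ ∁ C) (endpoints (filter outside? M))
    outside-endpoints M =
      All-endpoints (λ (a∉C , b∉C) → x∉p⇒x∈∁p a∉C , x∉p⇒x∈∁p b∉C) (AllP.all-filter outside? M)

    P-endpoints⊆C : ∀ {x} → x ∈ N G K ∪ (K - v) → x ∈ C
    P-endpoints⊆C x∈ with x∈p∪q⁻ (N G K) (K - v) x∈
    ... | inj₁ x∈NK  = x∈p∪q⁺ (inj₂ x∈NK)
    ... | inj₂ x∈K-v = x∈p∪q⁺ (inj₁ (p─q⊆p K ⁅ v ⁆ x∈K-v))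

    augment-matching : ∀ {M} → IsMatching G M → IsMatching G (augment M)
    augment-matching {M} M-matching =
      IsMatching-++ (λ x∈P x∈∁C → x∈∁p⇒x∉p x∈∁C (P-endpoints⊆C x∈P))
        (endpoints-FromTo (from-to P)) (outside-endpoints M) (matching P) (IsMatching-filter outside? M-matching)

    augment-uncovers-v : ∀ M → ¬ Covers (augment M) v
    augment-uncovers-v M v∈augment
      with ∈-++⁻ (endpoints (edges P)) (subst (v ∈ₗ_) (endpoints-++ (edges P) (filter outside? M)) v∈augment)
    ... | inj₂ v∈outside = x∈∁p⇒x∉p (All.lookup (outside-endpoints M) v∈outside) (x∈p∪q⁺ (inj₁ v∈K))
    ... | inj₁ v∈P with x∈p∪q⁻ (N G K) (K - v) (All.lookup (endpoints-FromTo (from-to P)) v∈P)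
    ...   | inj₁ v∈NK  = K-independent v∈K v∈NK
    ...   | inj₂ v∈K-v = x∈p─q⇒x∉q K ⁅ v ⁆ v∈K-v (x∈⁅x⁆ v)

    touching⇒Meets-NK : ∀ {a b} → Adjacent G a b → ¬ Outside (a , b) → Meets (N G K) (a , b)
    touching⇒Meets-NK {a} {b} a~b touching with a ∈? C | b ∈? C
    ... | no a∉C | no b∉C = contradiction (a∉C , b∉C) touching
    ... | yes a∈C | _ with x∈p∪q⁻ K (N G K) a∈C
    ...   | inj₁ a∈K  = inj₂ (∈N⁺ a∈K a~b)
    ...   | inj₂ a∈NK = inj₁ a∈NK
    touching⇒Meets-NK {a} {b} a~b touching | no _ | yes b∈C with x∈p∪q⁻ K (N G K) b∈C
    ...   | inj₁ b∈K  = inj₁ (∈N⁺ b∈K (Adjacent-sym a~b))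
    ...   | inj₂ b∈NK = inj₂ b∈NK

    augment-gain : ∀ k M → k + length (filter touching? M) ≤ ∣ N G K ∣ → k + length M ≤ length (augment M)
    augment-gain k M bound = begin
      k + length M                                     ≡⟨ cong (k +_) (length≡length-filter+length-filter¬ outside? M) ⟩
      k + (length outside-part + length touching-part) ≡⟨ rearrange k (length outside-part) (length touching-part) ⟩
      length outside-part + (k + length touching-part) ≤⟨ +-monoʳ-≤ (length outside-part) (≤-trans bound (saturating P)) ⟩
      length outside-part + length (edges P)           ≡⟨ +-comm (length outside-part) (length (edges P)) ⟩
      length (edges P) + length outside-part           ≡⟨ length-++ (edges P) ⟨
      length (augment M)                               ∎
      where
      open ≤-Reasoning
      outside-part touching-part : List (Fin n × Fin n)
      outside-part  = filter outside? M
      touching-part = filter touching? M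
      rearrange : ∀ a b c → a + (b + c) ≡ b + (a + c)
      rearrange = solve-∀

    touching-part-meets : ∀ {M} → IsMatching G M → All (Meets (N G K)) (filter touching? M)
    touching-part-meets {M} (M-adjacent , _) =
      All.zipWith (λ (a~b , touching) → touching⇒Meets-NK a~b touching)
        (AllP.filter⁺ touching? M-adjacent , AllP.all-filter touching? M)

    augment-length : ∀ {M} → IsMatching G M → length M ≤ length (augment M)
    augment-length {M} M-matching = augment-gain 0 M
      (length≤∣S∣ (Unique-endpoints-filter touching? M (proj₂ M-matching)) (touching-part-meets M-matching))

    augment-length-uncovered : ∀ {M u} → IsMatching G M → u ∈ N G K → ¬ Covers M u →
      1 + length M ≤ length (augment M)
    augment-length-uncovered {M} {u} M-matching u∈NK u∉M = augment-gain 1 M (<-≤-trans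
      (s≤s (length≤∣S∣ (Unique-endpoints-filter touching? M (proj₂ M-matching))
        (Meets-─ (All-endpoints-filter touching? M (AllP.¬Any⇒All¬ (endpoints M) u∉M)) (touching-part-meets M-matching))))
      (x∈p⇒∣p-x∣<∣p∣ u∈NK))

    augment-maximum : ∀ {M} → IsMaximumMatching G M → IsMaximumMatching G (augment M)
    augment-maximum (M-matching , M-maximum) =
      augment-matching M-matching ,
      λ M′ M′-matching → ≤-trans (M-maximum M′ M′-matching) (augment-length M-matching)

    v∈D : InD G v
    v∈D = let M , M-maximum = maximum-matching in
      augment M , augment-maximum M-maximum , augment-uncovers-v M

    N[K]#D : ∀ {u} → u ∈ N G K → ¬ InD G u
    N[K]#D u∈NK (M , (M-matching , M-maximum) , u∉M) =
      <⇒≱ (augment-length-uncovered M-matching u∈NK u∉M) (M-maximum (augment M) (augment-matching M-matching))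

ReachD⇒InD : ∀ {G : Graph n} {u w} → ReachD G u w → InD G u
ReachD⇒InD (here u∈D)     = u∈D
ReachD⇒InD (step u∈D _ _) = u∈D

corollary5p6 : ∀ {n : ℕ} (G : Graph n) (v : Fin n) →
    InKer G v → InSingletonComponentOfD G v
corollary5p6 G v v∈ker with minimum-critical G
... | K , K-critical , K-minimum = v∈D , v-isolated
  where
  open MinimumCritical G {K} K-critical (λ {B} → K-minimum {B})

  v∈K : v ∈ K
  v∈K = v∈ker K K-critical

  P : Saturating G (N G K) (K - v)
  P = hall G (λ x∈NK x∈K-v → independent (p─q⊆p K ⁅ v ⁆ x∈K-v) x∈NK)
             (PositiveSurplus⇒HallCondition G surplus v)

  open Augmentation G independent v∈K P

  v-isolated : ∀ w → ReachD G v w → w ≡ v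
  v-isolated _ (here _)         = refl
  v-isolated _ (step _ v~u u⇝w) = contradiction (ReachD⇒InD u⇝w) (N[K]#D (∈N⁺ G v∈K v~u))
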